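{- Let $X$ be a finite set, $\mathcal{C}$ a set of partial characters on $X$, $H$ a minimal triangulation of $\operatorname{int}(\mathcal{C})$, $(T,\mathcal{K})$ a clique tree of $H$, and suppose $(T,\mathcal{K})$ induces the $X$-tree $\mathcal{T}$. Then for each vertex $(A,\chi)$ of $\operatorname{int}(\mathcal{C})$, $\mathcal{T}(A) = T_{\mathcal{K}}(A,\chi)$.
   Context: A partial character on $X$ is a partition $\chi$ of a subset of $X$ into nonempty cells. The partition intersection graph $\operatorname{int}(\mathcal{C})$ has vertex set $\{(A,\chi):\chi\in\mathcal{C}, A\text{ a cell of }\chi\}$, distinct vertices $(A,\chi),(A',\chi')$ adjacent iff $A\cap A'\ne\emptyset$. A triangulation of a graph $G$ is a chordal graph obtained from $G$ by adding edges; it is minimal if no proper subset of the added edges yields a triangulation. A clique tree of a chordal graph $G$ is a pair $(T,\mathcal{K})$ with $T$ a tree and $\mathcal{K}$ a bijection from $V(T)$ onto the maximal cliques of $G$ such that vertices $x,y$ are adjacent iff both lie in some $\mathcal{K}(v)$, and for each vertex $x$ the nodes $v$ with $x\in\mathcal{K}(v)$ induce a connected subtree. For a vertex $(A,\chi)$, $T_{\mathcal{K}}(A,\chi)$ denotes the subtree of $T$ consisting of the nodes $v$ with $(A,\chi)\in\mathcal{K}(v)$. An $X$-tree is a pair $\mathcal{T}=(T',\phi)$ where $T'$ is a tree and $\phi:X\to V(T')$ is a map such that every node of degree one or two lies in the image of $\phi$; for $A\subseteq X$, $\mathcal{T}(A)$ is the minimal subtree of $T'$ containing $\phi(A)$.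 Given a clique tree $(T,\mathcal{K})$ of a triangulation of $\operatorname{int}(\mathcal{C})$, a node $v$ is a candidate node for $a\in X$ if $\mathcal{K}(v)$ contains every vertex $(A,\chi)$ of $\operatorname{int}(\mathcal{C})$ with $a\in A$. An $X$-tree induced by $(T,\mathcal{K})$ is obtained by choosing for each $a\in X$ a candidate node $\phi(a)$, and then suppressing every node of $T$ not in the image of $\phi$ that has degree two. (When $H$ is a minimal triangulation no suppression occurs, so $\mathcal{T}(A)$ and $T_{\mathcal{K}}(A,\chi)$ are subtrees of the same tree $T$.) -}

module Defs where

open import Data.Nat using (ℕ; zero; suc; pred; _≤_; _<_)
open import Data.Fin using (Fin)
open import Data.Fin.Subset using (Subset; _∈_; Nonempty)
open import Data.List using (List; length; lookup)
open import Data.List.Membership.Propositional renaming (_∈_ to _∈ₗ_)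
open import Data.List.Relation.Unary.All using (All)
open import Data.List.Relation.Unary.AllPairs using (AllPairs)
open import Data.Product using (Σ; ∃; _×_; _,_)
open import Data.Empty using (⊥)
open import Data.Unit using (⊤)
open import Relation.Nullary using (¬_)
open import Relation.Binary.PropositionalEquality using (_≡_; _≢_)
open import Function.Bundles using (_⇔_)

Rel₀ : Set → Set₁
Rel₀ V = V → V → Set

SymmetricG : {V : Set} → Rel₀ V → Set
SymmetricG {V} E = ∀ (x y : V) → E x y → E y x

IrreflexiveG : {V : Set} → Rel₀ V → Set
IrreflexiveG {V} E = ∀ (x : V) → ¬ E x x

IsGraph : {V : Set} → Rel₀ V → Set
IsGraph E = SymmetricG E × IrreflexiveG E

_⊆E_ : {V : Set} → Rel₀ V → Rel₀ V → Set
_⊆E_ {V} E E' = ∀ (x y : V) → E x y → E' x y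

record Cycle {V : Set} (E : Rel₀ V) (m k : ℕ) (f : ℕ → V) : Set where
  field
    long  : m ≤ k
    inj   : ∀ i j → i < k → j < k → f i ≡ f j → i ≡ j
    step  : ∀ i → suc i < k → E (f i) (f (suc i))
    close : E (f (pred k)) (f 0)

HasChord : {V : Set} → Rel₀ V → ℕ → (ℕ → V) → Set
HasChord E k f =
  Σ ℕ λ i → Σ ℕ λ j →
    suc i < j × j < k × ¬ (i ≡ 0 × suc j ≡ k) × E (f i) (f j)

Chordal : {V : Set} → Rel₀ V → Set
Chordal {V} E = ∀ (k : ℕ) (f : ℕ → V) → Cycle E 4 k f → HasChord E k f

data PathIn {V : Set} (E : Rel₀ V) (U : V → Set) : V → V → Set where
  here : ∀ {u} → U u → PathIn E U u u
  step : ∀ {u w v} → U u → E u w → PathIn E U w v → PathIn E U u v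

ConnectedSet : {V : Set} → Rel₀ V → (V → Set) → Set
ConnectedSet {V} E U = ∀ (u v : V) → U u → U v → PathIn E U u v

IsTree : {t : ℕ} → Rel₀ (Fin t) → Set
IsTree {t} T =
  IsGraph T × ConnectedSet T (λ _ → ⊤) ×
  (∀ (k : ℕ) (f : ℕ → Fin t) → ¬ Cycle T 3 k f)

Subtree : {t : ℕ} → Rel₀ (Fin t) → (Fin t → Set) → Set
Subtree T U = ConnectedSet T U

_⊆P_ : {A : Set} → (A → Set) → (A → Set) → Set
_⊆P_ {A} P Q = ∀ (a : A) → P a → Q a

IsMinimalSubtreeContaining : {t : ℕ} → Rel₀ (Fin t) → (Fin t → Set) → (Fin t → Set) → Set₁
IsMinimalSubtreeContaining {t} T S U =
  Subtree T U × S ⊆P U × (∀ (U' : Fin t → Set) → Subtree T U' → S ⊆P U' → U ⊆P U')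

Triangulation : {V : Set} → Rel₀ V → Rel₀ V → Set
Triangulation G H = IsGraph H × G ⊆E H × Chordal H

MinimalTriangulation : {V : Set} → Rel₀ V → Rel₀ V → Set₁
MinimalTriangulation {V} G H =
  Triangulation G H ×
  (∀ (H' : Rel₀ V) → Triangulation G H' → H' ⊆E H → H ⊆E H')

IsClique : {V : Set} → Rel₀ V → (V → Set) → Set
IsClique {V} H Q = ∀ (x y : V) → Q x → Q y → x ≢ y → H x y

IsMaximalClique : {V : Set} → Rel₀ V → (V → Set) → Set₁
IsMaximalClique {V} H Q =
  IsClique H Q × (∀ (Q' : V → Set) → IsClique H Q' → Q ⊆P Q' → Q' ⊆P Q)

SameSet : {A : Set} → (A → Set) → (A → Set) → Set
SameSet {A} P Q = ∀ (a : A) → P a ⇔ Q a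

-- (T , K) is a clique tree of H: T a tree on nodes Fin t, K a bijection from
-- the nodes onto the maximal cliques of H (cliques as predicates, up to
-- extensional equality), adjacency = co-membership in some K v, and the
-- nodes containing any given vertex induce a connected subtree.
record CliqueTree {V : Set} (H : Rel₀ V) {t : ℕ} (T : Rel₀ (Fin t))
                  (K : Fin t → V → Set) : Set₁ where
  field
    tree      : IsTree T
    maximal   : ∀ (v : Fin t) → IsMaximalClique H (K v)
    injective : ∀ (u v : Fin t) → SameSet (K u) (K v) → u ≡ v
    surjective : ∀ (Q : V → Set) → IsMaximalClique H Q → ∃ λ v → SameSet Q (K v)
    adjacency : ∀ (x y : V) → x ≢ y → H x y ⇔ (∃ λ v → K v x × K v y)
    connected : ∀ (x : V) → Subtree T (λ v → K v x)

Disjoint : {n : ℕ} → Subset n → Subset n → Set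
Disjoint {n} p q = ∀ (a : Fin n) → a ∈ p → a ∈ q → ⊥

-- a partition of a subset of X into nonempty (pairwise disjoint) cells
record PartialCharacter (n : ℕ) : Set where
  field
    cells    : List (Subset n)
    nonempty : All Nonempty cells
    disjoint : AllPairs Disjoint cells
open PartialCharacter public

-- a set of partial characters, given as an indexed family of pairwise
-- distinct partial characters (distinct = different sets of cells)
DistinctCharacters : {n k : ℕ} → (Fin k → PartialCharacter n) → Set
DistinctCharacters {n} {k} C =
  ∀ (i j : Fin k) → (∀ (A : Subset n) → (A ∈ₗ cells (C i)) ⇔ (A ∈ₗ cells (C j))) → i ≡ j

-- vertices (A , χ) of int(C): a character index and a cell index
Vtx : {n k : ℕ} → (Fin k → PartialCharacter n) → Set
Vtx {n} {k} C = Σ (Fin k) λ i → Fin (length (cells (C i)))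

cellOf : {n k : ℕ} (C : Fin k → PartialCharacter n) → Vtx C → Subset n
cellOf C (i , j) = lookup (cells (C i)) j

Int : {n k : ℕ} (C : Fin k → PartialCharacter n) → Rel₀ (Vtx C)
Int {n} C x y = x ≢ y × (∃ λ (a : Fin n) → a ∈ cellOf C x × a ∈ cellOf C y)

Candidate : {n k t : ℕ} (C : Fin k → PartialCharacter n) →
            (Fin t → Vtx C → Set) → Fin t → Fin n → Set
Candidate C K v a = ∀ (x : Vtx C) → a ∈ cellOf C x → K v x

-- Only minimality needs proof. Suppose a node v whose clique contains x is neither a φ(a), a ∈ A,
-- nor separates the nodes φ(a) in T. Then a simple path inside T_K(x) from φ(a₀) through v can always
-- be prolonged past its end c: otherwise a vertex y of K(c) missing from the clique of the previous
-- node shares no node other than c with x, so by minimality of the triangulation x y is an edge of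
-- int(C); the candidate node of an element common to the cells of x and y then lies in K(c) ∩ K(y),
-- hence is c, and the path back to φ(a₀) together with the bypass of v closes a cycle in T.
-- Simple paths in a finite tree cannot grow forever.
module Submission where

open import Defs
open import Data.Nat
  using (ℕ; zero; suc; pred; _+_; _∸_; _≤_; _<_; z≤n; s≤s; s≤s⁻¹; z<s; s<s; _≤‴_; ≤‴-reflexive; ≤‴-step; _<?_; >-nonZero)
open import Data.Nat.Properties
open import Data.Fin as Fin using (Fin; toℕ) renaming (_≟_ to _≟ᶠ_)
open import Data.Fin.Properties using (pigeonhole; toℕ<n; any?)
open import Data.Fin.Subset using (Subset; _∈_)
open import Data.Fin.Subset.Properties using (_∈?_)
open import Data.List.Membership.Propositional.Properties using (∈-lookup)
import Data.List.Relation.Unary.All as All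
open import Data.Product using (∃; _×_; _,_; proj₁; proj₂)
open import Data.Product.Properties using (≡-dec)
open import Data.Sum using (_⊎_; inj₁; inj₂; map; map₁)
open import Data.Empty using (⊥; ⊥-elim)
open import Function using (_∘_)
open import Function.Bundles using (Equivalence; mk⇔)
open import Relation.Nullary using (¬_; yes; no)
open import Relation.Nullary.Decidable using (_×-dec_; _⊎-dec_)
open import Relation.Binary.Definitions using (DecidableEquality; tri<; tri≈; tri>)
open import Relation.Binary.PropositionalEquality

_∖_ : {V : Set} → (V → Set) → V → V → Set
(U ∖ c) z = U z × z ≢ c

¬¬-∀-Fin : ∀ {m} {P : Fin m → Set} → (∀ i → ¬ ¬ P i) → ¬ ¬ (∀ i → P i)
¬¬-∀-Fin {zero} _ ¬∀P = ¬∀P λ ()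
¬¬-∀-Fin {suc m} ¬¬P ¬∀P =
  ¬¬P Fin.zero λ P₀ → ¬¬-∀-Fin (¬¬P ∘ Fin.suc) λ P₊ → ¬∀P λ { Fin.zero → P₀ ; (Fin.suc i) → P₊ i }

⊎-∀-Fin : ∀ {m} {Q : Set} {R : Fin m → Set} → (∀ i → Q ⊎ R i) → Q ⊎ (∀ i → R i)
⊎-∀-Fin {zero} _ = inj₂ λ ()
⊎-∀-Fin {suc m} Q⊎R with Q⊎R Fin.zero | ⊎-∀-Fin (Q⊎R ∘ Fin.suc)
... | inj₁ q | _ = inj₁ q
... | inj₂ _ | inj₁ q = inj₁ q
... | inj₂ R₀ | inj₂ R₊ = inj₂ λ { Fin.zero → R₀ ; (Fin.suc i) → R₊ i }

module _ {V : Set} {E : Rel₀ V} where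

  path-source : ∀ {U a b} → PathIn E U a b → U a
  path-source (here u) = u
  path-source (step u _ _) = u

  path-map : ∀ {U U' a b} → U ⊆P U' → PathIn E U a b → PathIn E U' a b
  path-map U⊆U' (here {u} u∈U) = here (U⊆U' u u∈U)
  path-map U⊆U' (step {u} u∈U e p) = step (U⊆U' u u∈U) e (path-map U⊆U' p)

  infixr 5 _++ₚ_
  _++ₚ_ : ∀ {U a b c} → PathIn E U a b → PathIn E U b c → PathIn E U a c
  here _ ++ₚ q = q
  step u∈U e p ++ₚ q = step u∈U e (p ++ₚ q)

  path-reverse : SymmetricG E → ∀ {U a b} → PathIn E U a b → PathIn E U b a
  path-reverse E-sym (here u∈U) = here u∈U
  path-reverse E-sym (step {u} {w} u∈U e p) =
    path-reverse E-sym p ++ₚ step (path-source p) (E-sym u w e) (here u∈U)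

  data LastVisit (U : V → Set) (c a b : V) : Set where
    avoids : PathIn E (U ∖ c) a b → LastVisit U c a b
    visits : U c → (c ≡ b ⊎ ∃ λ w → E c w × PathIn E (U ∖ c) w b) → LastVisit U c a b

  last-visit : DecidableEquality V → ∀ {U a b} c → PathIn E U a b → LastVisit U c a b
  last-visit _≟_ c (here {u} u∈U) with u ≟ c
  ... | yes refl = visits u∈U (inj₁ refl)
  ... | no u≢c = avoids (here (u∈U , u≢c))
  last-visit _≟_ c (step {u} {w} u∈U e p) with last-visit _≟_ c p
  ... | visits c∈U rest = visits c∈U rest
  ... | avoids q with u ≟ c
  ...   | yes refl = visits u∈U (inj₂ (w , e , q))
  ...   | no u≢c = avoids (step (u∈U , u≢c) e q)

  leave : DecidableEquality V → ∀ {U c c'} → c ≢ c' → PathIn E U c c' →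
          ∃ λ w → E c w × PathIn E (U ∖ c) w c'
  leave _≟_ {c = c} c≢c' p with last-visit _≟_ c p
  ... | avoids q = ⊥-elim (proj₂ (path-source q) refl)
  ... | visits _ (inj₁ c≡c') = ⊥-elim (c≢c' c≡c')
  ... | visits _ (inj₂ step-out) = step-out

  record SimplePath (U : V → Set) (a b : V) : Set where
    field
      len       : ℕ
      at        : ℕ → V
      at-0      : at 0 ≡ a
      at-len    : at len ≡ b
      adjacent  : ∀ i → i < len → E (at i) (at (suc i))
      injective : ∀ i j → i ≤ len → j ≤ len → at i ≡ at j → i ≡ j
      inside    : ∀ i → i ≤ len → U (at i)

  open SimplePath

  prepend : ∀ {U a b w} (p : SimplePath U a b) → E w a → U w → (∀ i → i ≤ len p → at p i ≢ w) →
            SimplePath U w b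
  prepend {U} {w = w} p w-a w∈U fresh = record
    { len = suc (len p) ; at = at' ; at-0 = refl ; at-len = at-len p
    ; adjacent = adjacent' ; injective = injective' ; inside = inside' }
    where
    at' : ℕ → V
    at' zero = w
    at' (suc i) = at p i
    adjacent' : ∀ i → i < suc (len p) → E (at' i) (at' (suc i))
    adjacent' zero _ = subst (E w) (sym (at-0 p)) w-a
    adjacent' (suc i) (s≤s i<len) = adjacent p i i<len
    injective' : ∀ i j → i ≤ suc (len p) → j ≤ suc (len p) → at' i ≡ at' j → i ≡ j
    injective' zero zero _ _ _ = refl
    injective' zero (suc j) _ (s≤s j≤) eq = ⊥-elim (fresh j j≤ (sym eq))
    injective' (suc i) zero (s≤s i≤) _ eq = ⊥-elim (fresh i i≤ eq)
    injective' (suc i) (suc j) (s≤s i≤) (s≤s j≤) eq = cong suc (injective p i j i≤ j≤ eq)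
    inside' : ∀ i → i ≤ suc (len p) → U (at' i)
    inside' zero _ = w∈U
    inside' (suc i) (s≤s i≤) = inside p i i≤

  suffix : ∀ {U a b} (p : SimplePath U a b) i → i ≤ len p → SimplePath U (at p i) b
  suffix p i i≤len = record
    { len = len p ∸ i ; at = λ n → at p (n + i) ; at-0 = refl
    ; at-len = trans (cong (at p) (m∸n+n≡m i≤len)) (at-len p)
    ; adjacent = λ n n< → adjacent p (n + i) (shift n<)
    ; injective = λ m n m≤ n≤ eq → +-cancelʳ-≡ i m n (injective p (m + i) (n + i) (shift m≤) (shift n≤) eq)
    ; inside = λ n n≤ → inside p (n + i) (shift n≤) }
    where
    shift : ∀ {n} → n ≤ len p ∸ i → n + i ≤ len p
    shift n≤ = subst (_ ≤_) (m∸n+n≡m i≤len) (+-monoˡ-≤ i n≤)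

  simple-path : DecidableEquality V → ∀ {U a b} → PathIn E U a b → SimplePath U a b
  simple-path _ (here {u} u∈U) = record
    { len = 0 ; at = λ _ → u ; at-0 = refl ; at-len = refl ; adjacent = λ _ ()
    ; injective = λ { zero zero _ _ _ → refl } ; inside = λ _ _ → u∈U }
  simple-path _≟_ (step {u} u∈U e p) with simple-path _≟_ p
  ... | q with anyUpTo? (λ i → at q i ≟ u) (suc (len q))
  ...   | yes (i , s≤s i≤len , at-i≡u) = subst (λ z → SimplePath _ z _) at-i≡u (suffix q i i≤len)
  ...   | no u∉q = prepend q e u∈U (λ i i≤len at-i≡u → u∉q (i , s≤s i≤len , at-i≡u))

  module _ {U a b} (p : SimplePath U a b) where

    at-outside : ∀ {i j r} → r ≤ len p → (r < i ⊎ j < r) → i ≤ j → j ≤ len p → at p i ≢ at p r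
    at-outside {i} {j} {r} r≤len outside i≤j j≤len eq =
      outside⇒≢ outside (injective p i r (≤-trans i≤j j≤len) r≤len eq)
      where
      outside⇒≢ : r < i ⊎ j < r → i ≢ r
      outside⇒≢ (inj₁ r<i) refl = <-irrefl refl r<i
      outside⇒≢ (inj₂ j<r) refl = <⇒≱ j<r i≤j

    segment-avoiding : ∀ {i j} r → r ≤ len p → (r < i ⊎ j < r) → i ≤ j → j ≤ len p →
                       PathIn E (_≢ at p r) (at p i) (at p j)
    segment-avoiding {j = j} r r≤len outside i≤j j≤len = go outside (≤⇒≤‴ i≤j)
      where
      go : ∀ {i} → (r < i ⊎ j < r) → i ≤‴ j → PathIn E (_≢ at p r) (at p i) (at p j)
      go outside (≤‴-reflexive refl) = here (at-outside r≤len outside ≤-refl j≤len)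
      go {i} outside i≤‴j@(≤‴-step i<j) =
        step (at-outside r≤len outside (≤‴⇒≤ i≤‴j) j≤len)
             (adjacent p i (<-≤-trans (≤‴⇒≤ i<j) j≤len))
             (go (map₁ m<n⇒m<1+n outside) i<j)

open SimplePath

SimplePath-len< : ∀ {t} {E : Rel₀ (Fin t)} {U a b} (p : SimplePath {E = E} U a b) → len p < t
SimplePath-len< {t} p with len p <? t
... | yes len<t = len<t
... | no len≮t with pigeonhole (s≤s (≮⇒≥ len≮t)) (at p ∘ toℕ)
...   | i , j , i<j , eq = ⊥-elim (<-irrefl (injective p _ _ (bound i) (bound j) eq) i<j)
  where
  bound : ∀ (i : Fin (suc (len p))) → toℕ i ≤ len p
  bound i = s≤s⁻¹ (toℕ<n i)

module _ {t : ℕ} {T : Rel₀ (Fin t)} (tree : IsTree T) where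

  private
    T-sym : SymmetricG T
    T-sym = proj₁ (proj₁ tree)

    T-irrefl : IrreflexiveG T
    T-irrefl = proj₂ (proj₁ tree)

  joined-neighbours-≡ : ∀ {v u₁ u₂} → T v u₁ → T v u₂ → PathIn T (_≢ v) u₁ u₂ → u₁ ≡ u₂
  joined-neighbours-≡ {v} {u₁} {u₂} v-u₁ v-u₂ detour with u₁ ≟ᶠ u₂
  ... | yes u₁≡u₂ = u₁≡u₂
  ... | no u₁≢u₂ = ⊥-elim (proj₂ (proj₂ tree) (2 + len p) node cycle)
    where
    p = simple-path _≟ᶠ_ detour
    node : ℕ → Fin t
    node zero = v
    node (suc i) = at p i
    1≤len : 1 ≤ len p
    1≤len = n≢0⇒n>0 λ len≡0 →
      u₁≢u₂ (trans (sym (at-0 p)) (trans (cong (at p) (sym len≡0)) (at-len p)))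
    node-injective : ∀ i j → i < 2 + len p → j < 2 + len p → node i ≡ node j → i ≡ j
    node-injective zero zero _ _ _ = refl
    node-injective zero (suc j) _ (s≤s j≤) eq = ⊥-elim (inside p j (s≤s⁻¹ j≤) (sym eq))
    node-injective (suc i) zero (s≤s i≤) _ eq = ⊥-elim (inside p i (s≤s⁻¹ i≤) eq)
    node-injective (suc i) (suc j) (s≤s i≤) (s≤s j≤) eq =
      cong suc (injective p i j (s≤s⁻¹ i≤) (s≤s⁻¹ j≤) eq)
    node-adjacent : ∀ i → suc i < 2 + len p → T (node i) (node (suc i))
    node-adjacent zero _ = subst (T v) (sym (at-0 p)) v-u₁
    node-adjacent (suc i) (s≤s (s≤s i<len)) = adjacent p i i<len
    cycle : Cycle T 3 (2 + len p) node
    cycle = record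
      { long = s≤s (s≤s 1≤len)
      ; inj = node-injective
      ; step = node-adjacent
      ; close = subst (λ z → T z v) (sym (at-len p)) (T-sym v u₂ v-u₂) }

  common-first-step : ∀ {X Y : Fin t → Set} {c c'} → c ≢ c' → PathIn T X c c' → PathIn T Y c c' →
                      ∃ λ w → T c w × X w × Y w
  common-first-step c≢c' p q with leave _≟ᶠ_ c≢c' p | leave _≟ᶠ_ c≢c' q
  ... | w₁ , c-w₁ , p' | w₂ , c-w₂ , q' =
    w₁ , c-w₁ , proj₁ (path-source p') ,
    subst _ (sym w₁≡w₂) (proj₁ (path-source q'))
    where
    w₁≡w₂ = joined-neighbours-≡ c-w₁ c-w₂
              (path-map (λ _ → proj₂) p' ++ₚ path-reverse T-sym (path-map (λ _ → proj₂) q'))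

  helly : ∀ {X Y Z : Fin t → Set} {v w₁ w₂} → Subtree T X → Subtree T Y → Subtree T Z →
          (∀ w → X w → Y w → w ≡ v) → X v → Y v → X w₁ → Z w₁ → Y w₂ → Z w₂ → Z v
  helly {X} {Y} {Z} {v} {w₁} {w₂} X-sub Y-sub Z-sub X∩Y⊆v Xv Yv Xw₁ Zw₁ Yw₂ Zw₂
    with last-visit _≟ᶠ_ v (Z-sub w₁ w₂ Zw₁ Zw₂)
  ... | visits Zv _ = Zv
  ... | avoids r with leave _≟ᶠ_ v≢w₁ (X-sub v w₁ Xv Xw₁) | leave _≟ᶠ_ v≢w₂ (Y-sub v w₂ Yv Yw₂)
    where
    v≢w₁ : v ≢ w₁
    v≢w₁ v≡w₁ = proj₂ (path-source r) (sym v≡w₁)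
    v≢w₂ : v ≢ w₂
    v≢w₂ v≡w₂ = proj₂ (path-source (path-reverse T-sym r)) (sym v≡w₂)
  ...   | u₁ , v-u₁ , p | u₂ , v-u₂ , q = ⊥-elim (T-irrefl v (subst (T v) u₁≡v v-u₁))
    where
    avoiding : ∀ {U : Fin t → Set} {a b} → PathIn T (U ∖ v) a b → PathIn T (_≢ v) a b
    avoiding = path-map (λ _ → proj₂)
    u₁≡u₂ : u₁ ≡ u₂
    u₁≡u₂ = joined-neighbours-≡ v-u₁ v-u₂
              (avoiding p ++ₚ avoiding r ++ₚ path-reverse T-sym (avoiding q))
    u₁≡v : u₁ ≡ v
    u₁≡v = X∩Y⊆v u₁ (proj₁ (path-source p)) (subst Y (sym u₁≡u₂) (proj₁ (path-source q)))

  neighbour-off-path : ∀ {U a b w} (p : SimplePath {E = T} U a b) → T a w → w ≢ at p 1 →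
                       ∀ i → i ≤ len p → at p i ≢ w
  neighbour-off-path {a = a} p a-w w≢u zero _ eq =
    T-irrefl a (subst (T a) (sym (trans (sym (at-0 p)) eq)) a-w)
  neighbour-off-path p a-w w≢u (suc zero) _ eq = w≢u (sym eq)
  neighbour-off-path {a = a} p a-w w≢u i@(suc (suc l)) i≤len eq =
    2+l≢1 (injective p i 1 i≤len 1≤len at-i≡at-1)
    where
    2+l≢1 : suc (suc l) ≢ 1
    2+l≢1 ()
    1≤len = ≤-trans (s≤s z≤n) i≤len
    back : PathIn T (_≢ a) (at p i) (at p 1)
    back = subst (λ z → PathIn T (_≢ z) _ _) (at-0 p)
             (path-reverse T-sym (segment-avoiding p 0 z≤n (inj₁ z<s) (s≤s z≤n) i≤len))
    at-i≡at-1 : at p i ≡ at p 1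
    at-i≡at-1 = joined-neighbours-≡ (subst (T a) (sym eq) a-w)
                  (subst (λ z → T z (at p 1)) (at-0 p) (adjacent p 0 1≤len)) back

punchIn : ℕ → ℕ → ℕ
punchIn zero n = suc n
punchIn (suc r) zero = zero
punchIn (suc r) (suc n) = suc (punchIn r n)

punchIn-below : ∀ {r n} → n < r → punchIn r n ≡ n
punchIn-below {suc r} {zero} _ = refl
punchIn-below {suc r} {suc n} (s≤s n<r) = cong suc (punchIn-below n<r)

punchIn-above : ∀ {r n} → r ≤ n → punchIn r n ≡ suc n
punchIn-above {zero} _ = refl
punchIn-above {suc r} {suc n} (s≤s r≤n) = cong suc (punchIn-above r≤n)

punchIn-≤ : ∀ r n → punchIn r n ≤ suc n
punchIn-≤ zero n = ≤-refl
punchIn-≤ (suc r) zero = z≤n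
punchIn-≤ (suc r) (suc n) = s≤s (punchIn-≤ r n)

punchIn-mono : ∀ r {a b} → a < b → punchIn r a < punchIn r b
punchIn-mono zero a<b = s≤s a<b
punchIn-mono (suc r) {zero} {suc b} _ = z<s
punchIn-mono (suc r) {suc a} {suc b} (s≤s a<b) = s≤s (punchIn-mono r a<b)

punchIn-suc : ∀ {r n} → n ≢ r → punchIn r n ≡ punchIn (suc r) n
punchIn-suc {r} {n} n≢r with <-cmp n r
... | tri< n<r _ _ = trans (punchIn-below n<r) (sym (punchIn-below (m<n⇒m<1+n n<r)))
... | tri≈ _ n≡r _ = ⊥-elim (n≢r n≡r)
... | tri> _ _ r<n = trans (punchIn-above (<⇒≤ r<n)) (sym (punchIn-above r<n))

Consecutive : ℕ → ℕ → ℕ → Set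
Consecutive k p q = suc p ≡ q ⊎ (p ≡ 0 × suc q ≡ k)

chord-not-consecutive : ∀ {k a b p q} → suc a < b → ¬ (a ≡ 0 × suc b ≡ k) → Consecutive k p q →
                        ¬ ((a ≡ p × b ≡ q) ⊎ (a ≡ q × b ≡ p))
chord-not-consecutive a+1<b no-wrap (inj₁ refl) (inj₁ (refl , refl)) = <-irrefl refl a+1<b
chord-not-consecutive a+1<b no-wrap (inj₂ wrap) (inj₁ (refl , refl)) = no-wrap wrap
chord-not-consecutive a+1<b no-wrap (inj₁ refl) (inj₂ (refl , refl)) =
  <-asym (<-trans (n<1+n _) a+1<b) ≤-refl
chord-not-consecutive a+1<b no-wrap (inj₂ (refl , _)) (inj₂ (refl , refl)) = n≮0 a+1<b

module _ {V : Set} where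

  SameEdge : V → V → V → V → Set
  SameEdge x y z w = (z ≡ x × w ≡ y) ⊎ (z ≡ y × w ≡ x)

  SameEdge-sym : ∀ {x y z w} → SameEdge x y z w → SameEdge x y w z
  SameEdge-sym (inj₁ (z≡x , w≡y)) = inj₂ (w≡y , z≡x)
  SameEdge-sym (inj₂ (z≡y , w≡x)) = inj₁ (w≡x , z≡y)

  deleteEdge : Rel₀ V → V → V → Rel₀ V
  deleteEdge H x y z w = H z w × ¬ SameEdge x y z w

module _ {V : Set} (_≟_ : DecidableEquality V) {H : Rel₀ V} (H-sym : SymmetricG H)
         (H-chordal : Chordal H) {x y : V} (common-clique : IsClique H (λ z → H x z × H z y)) where

  private
    H' = deleteEdge H x y

    common-neighbour : ∀ {a z b} → H a z → H z b → SameEdge x y a b → H x z × H z y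
    common-neighbour a-z z-b (inj₁ (refl , refl)) = a-z , z-b
    common-neighbour a-z z-b (inj₂ (refl , refl)) = H-sym _ _ z-b , H-sym _ _ a-z

  module OnCycle {k : ℕ} {f : ℕ → V} (cycle : Cycle H' 4 k f) where

    open Cycle cycle using (long; inj; close)

    cycleH : Cycle H 4 k f
    cycleH = record
      { long = long ; inj = inj ; step = λ i i+1<k → proj₁ (Cycle.step cycle i i+1<k) ; close = proj₁ close }

    same-edge-positions : ∀ {i j p q} → i < k → j < k → p < k → q < k →
                          SameEdge x y (f i) (f j) → SameEdge x y (f p) (f q) →
                          (p ≡ i × q ≡ j) ⊎ (p ≡ j × q ≡ i)
    same-edge-positions i< j< p< q< (inj₁ (i≡x , j≡y)) (inj₁ (p≡x , q≡y)) =
      inj₁ (inj _ _ p< i< (trans p≡x (sym i≡x)) , inj _ _ q< j< (trans q≡y (sym j≡y)))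
    same-edge-positions i< j< p< q< (inj₁ (i≡x , j≡y)) (inj₂ (p≡y , q≡x)) =
      inj₂ (inj _ _ p< j< (trans p≡y (sym j≡y)) , inj _ _ q< i< (trans q≡x (sym i≡x)))
    same-edge-positions i< j< p< q< (inj₂ (i≡y , j≡x)) (inj₁ (p≡x , q≡y)) =
      inj₂ (inj _ _ p< j< (trans p≡x (sym j≡x)) , inj _ _ q< i< (trans q≡y (sym i≡y)))
    same-edge-positions i< j< p< q< (inj₂ (i≡y , j≡x)) (inj₂ (p≡y , q≡x)) =
      inj₁ (inj _ _ p< i< (trans p≡y (sym i≡y)) , inj _ _ q< j< (trans q≡x (sym j≡x)))

    module Reindexed {k'} (σ : ℕ → ℕ) (σ-mono : ∀ {a b} → a < b → b < k' → σ a < σ b)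
                     (σ-bound : ∀ {a} → a < k' → σ a < k) where

      σ-injective : ∀ {a b} → a < k' → b < k' → σ a ≡ σ b → a ≡ b
      σ-injective {a} {b} a< b< eq with <-cmp a b
      ... | tri< a<b _ _ = ⊥-elim (<-irrefl eq (σ-mono a<b b<))
      ... | tri≈ _ a≡b _ = a≡b
      ... | tri> _ _ b<a = ⊥-elim (<-irrefl (sym eq) (σ-mono b<a a<))

      reindexed-injective : ∀ a b → a < k' → b < k' → f (σ a) ≡ f (σ b) → a ≡ b
      reindexed-injective a b a< b< eq = σ-injective a< b< (inj _ _ (σ-bound a<) (σ-bound b<) eq)

      -- The deleted edge is an edge of the reindexed cycle, so none of its chords is the deleted edge.
      chord-of-reindexed : ∀ {p q} → p < k' → q < k' → Consecutive k' p q →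
                           SameEdge x y (f (σ p)) (f (σ q)) →
                           HasChord H k' (f ∘ σ) → HasChord H' k f
      chord-of-reindexed p< q< consecutive same (a , b , a+1<b , b< , no-wrap , edge) =
        σ a , σ b , ≤-<-trans (σ-mono (n<1+n a) a+1<k') (σ-mono a+1<b b<) , σ-bound b< ,
        no-wrap' , edge , not-same
        where
        a+1<k' = <-trans a+1<b b<
        a<k' = <-trans (n<1+n a) a+1<k'
        first : ∀ {a} → a < k' → σ a ≡ 0 → a ≡ 0
        first {zero} _ _ = refl
        first {suc a} a< σa≡0 = ⊥-elim (n≮0 (subst (σ 0 <_) σa≡0 (σ-mono z<s a<)))
        last : suc (σ b) ≡ k → suc b ≡ k'
        last σb-last with m≤n⇒m<n∨m≡n b<
        ... | inj₂ b+1≡k' = b+1≡k'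
        ... | inj₁ b+1<k' =
          ⊥-elim (<-irrefl σb-last (≤-<-trans (σ-mono (n<1+n b) b+1<k') (σ-bound b+1<k')))
        no-wrap' : ¬ (σ a ≡ 0 × suc (σ b) ≡ k)
        no-wrap' (σa≡0 , σb-last) = no-wrap (first a<k' σa≡0 , last σb-last)
        not-same : ¬ SameEdge x y (f (σ a)) (f (σ b))
        not-same same' = chord-not-consecutive a+1<b no-wrap consecutive
          (map (λ (σa≡σp , σb≡σq) → σ-injective a<k' p< σa≡σp , σ-injective b< q< σb≡σq)
               (λ (σa≡σq , σb≡σp) → σ-injective a<k' q< σa≡σq , σ-injective b< p< σb≡σp)
             (same-edge-positions (σ-bound p<) (σ-bound q<) (σ-bound a<k') (σ-bound b<) same same'))

    chord-of-long-chord : ∀ {i j m} → i + m ≡ j → 3 ≤ m → j < k → H (f i) (f j) →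
                          SameEdge x y (f i) (f j) → HasChord H' k f
    chord-of-long-chord {i} {m = m} refl 3≤m j<k edge same =
      chord-of-reindexed z<s ≤-refl (inj₂ (refl , refl))
        (subst (λ z → SameEdge x y (f z) (f (i + m))) (sym (+-identityʳ i)) same)
        (H-chordal (suc m) (f ∘ (i +_)) arc)
      where
      bound : ∀ {a} → a < suc m → i + a < k
      bound a<m+1 = ≤-<-trans (+-monoʳ-≤ i (s≤s⁻¹ a<m+1)) j<k
      open Reindexed (i +_) (λ a<b _ → +-monoʳ-< i a<b) bound
      arc-step : ∀ a → suc a < suc m → H (f (i + a)) (f (i + suc a))
      arc-step a a+1<m+1 = subst (λ z → H (f (i + a)) (f z)) (sym (+-suc i a))
        (Cycle.step cycleH (i + a) (subst (_< k) (+-suc i a) (bound a+1<m+1)))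
      arc : Cycle H 4 (suc m) (f ∘ (i +_))
      arc = record
        { long = s≤s 3≤m
        ; inj = reindexed-injective
        ; step = arc-step
        ; close = subst (λ z → H (f (i + m)) (f z)) (sym (+-identityʳ i)) (H-sym _ _ edge) }

    chord-of-triangle : ∀ {i k'} → suc k' ≡ k → 4 ≤ k' → suc (suc i) < k →
                        H (f i) (f (suc (suc i))) → SameEdge x y (f i) (f (suc (suc i))) →
                        HasChord H' k f
    chord-of-triangle {i} {k'@(suc _)} k'+1≡k 4≤k' i+2<k edge same =
      chord-of-reindexed i<k' i+1<k' (inj₁ refl) (skip-apex (λ a b → SameEdge x y (f a) (f b)) same)
        (H-chordal k' (f ∘ σ) shortcut)
      where
      σ = punchIn (suc i)
      skip-apex : ∀ (P : ℕ → ℕ → Set) → P i (suc (suc i)) → P (σ i) (σ (suc i))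
      skip-apex P = subst₂ P (sym (punchIn-below (n<1+n i))) (sym (punchIn-above ≤-refl))
      i+1<k' : suc i < k'
      i+1<k' = s≤s⁻¹ (subst (suc (suc i) <_) (sym k'+1≡k) i+2<k)
      i<k' = <-trans (n<1+n i) i+1<k'
      bound : ∀ {a} → a < k' → σ a < k
      bound {a} a<k' = subst (σ a <_) k'+1≡k (s≤s (≤-trans (punchIn-≤ (suc i) a) a<k'))
      open Reindexed σ (λ a<b _ → punchIn-mono (suc i) a<b) bound
      off-chord : ∀ {n} → n ≢ i → suc n < k' → H (f (σ n)) (f (σ (suc n)))
      off-chord {n} n≢i n+1<k' = subst (λ z → H (f (σ n)) (f (suc z))) (sym (punchIn-suc n≢i))
        (Cycle.step cycleH (σ n) (subst (λ z → suc z < k) (punchIn-suc n≢i) (bound n+1<k')))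
      shortcut-step : ∀ n → suc n < k' → H (f (σ n)) (f (σ (suc n)))
      shortcut-step n n+1<k' with <-cmp n i
      ... | tri≈ _ refl _ = skip-apex (λ a b → H (f a) (f b)) edge
      ... | tri< _ n≢i _ = off-chord n≢i n+1<k'
      ... | tri> _ n≢i _ = off-chord n≢i n+1<k'
      shortcut : Cycle H 4 k' (f ∘ σ)
      shortcut = record
        { long = 4≤k'
        ; inj = reindexed-injective
        ; step = shortcut-step
        ; close = subst (λ z → H (f z) (f 0))
                    (trans (cong pred (sym k'+1≡k)) (sym (punchIn-above (pred-mono-≤ i+1<k'))))
                    (Cycle.close cycleH) }

    module Square (k≡4 : k ≡ 4) where

      private
        1<4 : 1 < 4
        1<4 = s<s z<s
        2<4 : 2 < 4
        2<4 = s<s (s<s z<s)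
        3<4 : 3 < 4
        3<4 = n<1+n 3
        <k : ∀ {n} → n < 4 → n < k
        <k = subst (_ <_) (sym k≡4)
        H-step : ∀ n → suc n < 4 → H (f n) (f (suc n))
        H-step n n+1<4 = Cycle.step cycleH n (<k n+1<4)
        H-close : H (f 3) (f 0)
        H-close = subst (λ z → H (f (pred z)) (f 0)) k≡4 (Cycle.close cycleH)

      -- On a square the deleted edge is a diagonal; the other one joins two common neighbours of x and y.
      chord-of-square : ∀ i → suc (suc i) < k → SameEdge x y (f i) (f (suc (suc i))) →
                        HasChord H' k f
      chord-of-square zero _ same =
        1 , 3 , ≤-refl , <k 3<4 , (λ { (() , _) }) ,
        common-clique _ _ (common-neighbour (H-step 0 1<4) (H-step 1 2<4) same)
                          (common-neighbour (H-step 2 3<4) H-close (SameEdge-sym same))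
                          (λ eq → 1≢3 (inj 1 3 (<k 1<4) (<k 3<4) eq)) ,
        λ same' → positions (same-edge-positions (<k z<s) (<k 2<4) (<k 1<4) (<k 3<4) same same')
        where
        1≢3 : 1 ≢ 3
        1≢3 ()
        positions : ¬ ((1 ≡ 0 × 3 ≡ 2) ⊎ (1 ≡ 2 × 3 ≡ 0))
        positions (inj₁ (() , _))
        positions (inj₂ (() , _))
      chord-of-square (suc zero) _ same =
        0 , 2 , ≤-refl , <k 2<4 , (λ (_ , 3≡k) → 3≢4 (trans 3≡k k≡4)) ,
        common-clique _ _ (common-neighbour H-close (H-step 0 1<4) (SameEdge-sym same))
                          (common-neighbour (H-step 1 2<4) (H-step 2 3<4) same)
                          (λ eq → 0≢2 (inj 0 2 (<k z<s) (<k 2<4) eq)) ,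
        λ same' → positions (same-edge-positions (<k 1<4) (<k 3<4) (<k z<s) (<k 2<4) same same')
        where
        0≢2 : 0 ≢ 2
        0≢2 ()
        3≢4 : 3 ≢ 4
        3≢4 ()
        positions : ¬ ((0 ≡ 1 × 2 ≡ 3) ⊎ (0 ≡ 3 × 2 ≡ 1))
        positions (inj₁ (() , _))
        positions (inj₂ (() , _))
      chord-of-square (suc (suc i)) i+4<k _ =
        ⊥-elim (n≮0 (s≤s⁻¹ (s≤s⁻¹ (s≤s⁻¹ (s≤s⁻¹ (subst (_ <_) k≡4 i+4<k))))))

    -- A chord in H that is the deleted edge splits the cycle; a chord of a piece with at least four
    -- vertices, closed up by the deleted edge, is then a chord in H'.
    chord : HasChord H' k f
    chord with H-chordal k f cycleH
    ... | i , j , i+1<j , j<k , no-wrap , edge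
      with (f i ≟ x ×-dec f j ≟ y) ⊎-dec (f i ≟ y ×-dec f j ≟ x)
    ...   | no different = i , j , i+1<j , j<k , no-wrap , edge , different
    ...   | yes same with m≤n⇒m<n∨m≡n i+1<j
    ...     | inj₁ i+2<j = chord-of-long-chord (m+[n∸m]≡n (≤-trans (n≤1+n i) (<⇒≤ i+1<j)))
                             (subst (_≤ j ∸ i) (m+n∸n≡m 3 i) (∸-monoˡ-≤ i i+2<j)) j<k edge same
    ...     | inj₂ refl with m≤n⇒m<n∨m≡n long
    ...       | inj₁ 4<k = chord-of-triangle (suc-pred k ⦃ >-nonZero (≤-trans (s≤s z≤n) 4<k) ⦄)
                             (pred-mono-≤ 4<k) j<k edge same
    ...       | inj₂ 4≡k = Square.chord-of-square (sym 4≡k) i j<k same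

  deleteEdge-chordal : Chordal (deleteEdge H x y)
  deleteEdge-chordal k f cycle = OnCycle.chord cycle

module _ {V : Set} {H : Rel₀ V} {t : ℕ} {T : Rel₀ (Fin t)} {K : Fin t → V → Set}
         (clique-tree : CliqueTree H T K) where

  open CliqueTree clique-tree using (tree; maximal) renaming (injective to K-injective)

  adjacent-cliques-⊈ : ∀ {c u} → T c u → ¬ (K c ⊆P K u)
  adjacent-cliques-⊈ {c} {u} c-u Kc⊆Ku = proj₂ (proj₁ tree) u (subst (λ z → T z u) c≡u c-u)
    where
    c≡u = K-injective c u λ z → mk⇔ (Kc⊆Ku z) (proj₂ (maximal c) (K u) (proj₁ (maximal u)) Kc⊆Ku z)

module _ {V : Set} (_≟_ : DecidableEquality V) {G H : Rel₀ V} (G-sym : SymmetricG G)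
         (minimal : MinimalTriangulation G H) {t : ℕ} {T : Rel₀ (Fin t)} {K : Fin t → V → Set}
         (clique-tree : CliqueTree H T K) where

  private
    open CliqueTree clique-tree using (tree; adjacency; connected)

    H-sym : SymmetricG H
    H-sym = proj₁ (proj₁ (proj₁ minimal))

    H-irrefl : IrreflexiveG H
    H-irrefl = proj₂ (proj₁ (proj₁ minimal))

    co-member⇒edge : ∀ {w a b} → K w a → K w b → a ≢ b → H a b
    co-member⇒edge {w} {a} {b} Kwa Kwb a≢b = Equivalence.from (adjacency a b a≢b) (w , Kwa , Kwb)

    edge⇒co-member : ∀ {a b} → H a b → ∃ λ w → K w a × K w b
    edge⇒co-member {a} {b} a-b = Equivalence.to (adjacency a b λ { refl → H-irrefl a a-b }) a-b

  -- By Helly, the common neighbours of x and y lie in the clique K v, so deleting the edge x y keeps H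
  -- chordal; minimality of H then rules out ¬ G x y.
  edge-in-unique-clique : ∀ {x y v} → x ≢ y → K v x → K v y → (∀ w → K w x → K w y → w ≡ v) →
                          ¬ ¬ G x y
  edge-in-unique-clique {x} {y} {v} x≢y Kvx Kvy unique ¬Gxy =
    proj₂ (H⊆H' x y (co-member⇒edge Kvx Kvy x≢y)) (inj₁ (refl , refl))
    where
    common-in-Kv : ∀ {z} → H x z × H z y → K v z
    common-in-Kv (x-z , z-y) with edge⇒co-member x-z | edge⇒co-member z-y
    ... | _ , K₁x , K₁z | _ , K₂z , K₂y =
      helly tree (connected x) (connected y) (connected _) unique Kvx Kvy K₁x K₁z K₂y K₂z
    triangulation : Triangulation G (deleteEdge H x y)
    triangulation =
      ((λ a b (a-b , ¬same) → H-sym a b a-b , ¬same ∘ SameEdge-sym) ,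
       (λ a (a-a , _) → H-irrefl a a-a)) ,
      (λ a b Gab → proj₁ (proj₂ (proj₁ minimal)) a b Gab ,
                   λ { (inj₁ (refl , refl)) → ¬Gxy Gab ; (inj₂ (refl , refl)) → ¬Gxy (G-sym a b Gab) }) ,
      deleteEdge-chordal _≟_ H-sym (proj₂ (proj₂ (proj₁ minimal)))
        (λ a b a∈ b∈ → co-member⇒edge (common-in-Kv a∈) (common-in-Kv b∈))
    H⊆H' : H ⊆E deleteEdge H x y
    H⊆H' = proj₂ minimal _ triangulation (λ _ _ → proj₁)

subtree-through-or-around : ∀ {n t} {T : Rel₀ (Fin t)} {U : Fin t → Set} → Subtree T U →
  (A : Subset n) (φ : Fin n → Fin t) → (∀ b → b ∈ A → U (φ b)) → ∀ {a₀} → a₀ ∈ A → ∀ v →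
  U v ⊎ (∀ b → b ∈ A → PathIn T (_≢ v) (φ a₀) (φ b))
subtree-through-or-around {T = T} {U} U-subtree A φ φ[A]⊆U {a₀} a₀∈A v = ⊎-∀-Fin through-or-around
  where
  through-or-around : ∀ b → U v ⊎ (b ∈ A → PathIn T (_≢ v) (φ a₀) (φ b))
  through-or-around b with b ∈? A
  ... | no b∉A = inj₂ (⊥-elim ∘ b∉A)
  ... | yes b∈A with last-visit _≟ᶠ_ v (U-subtree _ _ (φ[A]⊆U a₀ a₀∈A) (φ[A]⊆U b b∈A))
  ...   | visits v∈U _ = inj₁ v∈U
  ...   | avoids around = inj₂ λ _ → path-map (λ _ → proj₂) around

Int-sym : ∀ {n k} (C : Fin k → PartialCharacter n) → SymmetricG (Int C)
Int-sym C x y (x≢y , a , a∈x , a∈y) = (λ y≡x → x≢y (sym y≡x)) , a , a∈y , a∈x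

module Excursions {n k} {C : Fin k → PartialCharacter n} {H : Rel₀ (Vtx C)}
  (minimal : MinimalTriangulation (Int C) H) {t} {T : Rel₀ (Fin t)} {K : Fin t → Vtx C → Set}
  (clique-tree : CliqueTree H T K) {φ : Fin n → Fin t} (candidate : ∀ a → Candidate C K (φ a) a)
  (x : Vtx C) {v : Fin t} (Kvx : K v x) {a₀ : Fin n} (a₀∈x : a₀ ∈ cellOf C x)
  (v∉φ[x] : ∀ b → b ∈ cellOf C x → φ b ≢ v)
  (bypass : ∀ b → b ∈ cellOf C x → PathIn T (_≢ v) (φ a₀) (φ b)) where

  open CliqueTree clique-tree using (tree; connected)

  private
    T-sym : SymmetricG T
    T-sym = proj₁ (proj₁ tree)

    ¬¬-∀-Vtx : ∀ {P : Vtx C → Set} → (∀ z → ¬ ¬ P z) → ¬ ¬ (∀ z → P z)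
    ¬¬-∀-Vtx ¬¬P ¬∀P = ¬¬-∀-Fin (λ i → ¬¬-∀-Fin λ j → ¬¬P (i , j)) λ ∀P → ¬∀P λ (i , j) → ∀P i j

  record Excursion : Set where
    field
      end       : Fin t
      route     : SimplePath {E = T} (λ w → K w x) end (φ a₀)
      pivot     : ℕ
      pivot<len : pivot < len route
      at-pivot  : at route pivot ≡ v

  open Excursion

  end-outside-image : (e : Excursion) → ∀ b → b ∈ cellOf C x → φ b ≢ end e
  end-outside-image record { route = p ; pivot = zero ; at-pivot = at-0≡v } b b∈x φb≡end =
    v∉φ[x] b b∈x (trans φb≡end (trans (sym (at-0 p)) at-0≡v))
  end-outside-image record { route = p ; pivot = i@(suc j) ; pivot<len = i<len ; at-pivot = at-i≡v }
                    b b∈x φb≡end =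
    <-irrefl (sym (injective p (suc i) j i<len j≤len (joined-neighbours-≡ tree v-u₁ v-u₂ detour)))
             (<-trans (n<1+n j) (n<1+n i))
    where
    j≤len = ≤-trans (n≤1+n j) (<⇒≤ i<len)
    avoiding-v : ∀ {a b} → PathIn T (_≢ at p i) a b → PathIn T (_≢ v) a b
    avoiding-v = subst (λ z → PathIn T (_≢ z) _ _) at-i≡v
    v-u₁ : T v (at p (suc i))
    v-u₁ = subst (λ z → T z _) at-i≡v (adjacent p i i<len)
    v-u₂ : T v (at p j)
    v-u₂ = subst (λ z → T z _) at-i≡v (T-sym _ _ (adjacent p j (<-≤-trans (n<1+n j) (<⇒≤ i<len))))
    detour : PathIn T (_≢ v) (at p (suc i)) (at p j)
    detour = subst (PathIn T _ _) (at-len p)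
               (avoiding-v (segment-avoiding p i (<⇒≤ i<len) (inj₁ (n<1+n i)) i<len ≤-refl))
          ++ₚ bypass b b∈x
          ++ₚ subst (λ z → PathIn T _ z _) (trans (at-0 p) (sym φb≡end))
                (avoiding-v (segment-avoiding p i (<⇒≤ i<len) (inj₂ (n<1+n j)) z≤n j≤len))

  extend : (e : Excursion) → ∀ {w} → T (end e) w → K w x → w ≢ at (route e) 1 → Excursion
  extend e c-w Kwx w≢u = record
    { end = _
    ; route = prepend (route e) (T-sym _ _ c-w) Kwx (neighbour-off-path tree (route e) c-w w≢u)
    ; pivot = suc (pivot e)
    ; pivot<len = s≤s (pivot<len e)
    ; at-pivot = at-pivot e }

  excursion-continues : (e : Excursion) → ¬ ¬ (∃ λ w → T (end e) w × K w x × w ≢ at (route e) 1)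
  excursion-continues e stuck =
    ¬¬-∀-Vtx (λ y ¬[Kcy→Kuy] → ¬[Kcy→Kuy] λ Kcy →
               ⊥-elim (private-vertex y Kcy λ Kuy → ¬[Kcy→Kuy] λ _ → Kuy))
             (adjacent-cliques-⊈ clique-tree c-u)
    where
    p = route e
    c = end e
    u = at p 1
    1≤len = ≤-<-trans z≤n (pivot<len e)
    c-u : T c u
    c-u = subst (λ z → T z u) (at-0 p) (adjacent p 0 1≤len)
    Kcx : K c x
    Kcx = subst (λ z → K z x) (at-0 p) (inside p 0 z≤n)
    private-vertex : ∀ y → K c y → ¬ K u y → ⊥
    private-vertex y Kcy ¬Kuy =
      edge-in-unique-clique (≡-dec _≟ᶠ_ _≟ᶠ_) (Int-sym C) minimal clique-tree x≢y Kcx Kcy only-c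
        λ (_ , a , a∈x , a∈y) →
          end-outside-image e a a∈x (only-c (φ a) (candidate a x a∈x) (candidate a y a∈y))
      where
      x≢y : x ≢ y
      x≢y x≡y = ¬Kuy (subst (K u) x≡y (inside p 1 1≤len))
      only-c : ∀ w → K w x → K w y → w ≡ c
      only-c w Kwx Kwy with w ≟ᶠ c
      ... | yes w≡c = w≡c
      ... | no w≢c
        with common-first-step tree (w≢c ∘ sym) (connected x c w Kcx Kwx) (connected y c w Kcy Kwy)
      ...   | w' , c-w' , Kw'x , Kw'y =
        ⊥-elim (stuck (w' , c-w' , Kw'x , λ w'≡u → ¬Kuy (subst (λ z → K z y) w'≡u Kw'y)))

  no-long-excursion : ∀ N (e : Excursion) → t ≤ len (route e) + N → ⊥
  no-long-excursion zero e t≤len =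
    <⇒≱ (SimplePath-len< (route e)) (subst (t ≤_) (+-identityʳ _) t≤len)
  no-long-excursion (suc N) e t≤len+N+1 = excursion-continues e λ (w , c-w , Kwx , w≢u) →
    no-long-excursion N (extend e c-w Kwx w≢u) (subst (t ≤_) (+-suc _ N) t≤len+N+1)

  excursion : Excursion
  excursion = record { end = v ; route = p ; pivot = 0 ; pivot<len = n≢0⇒n>0 len≢0 ; at-pivot = at-0 p }
    where
    p = simple-path _≟ᶠ_ (connected x v (φ a₀) Kvx (candidate a₀ x a₀∈x))
    len≢0 : len p ≢ 0
    len≢0 len≡0 = v∉φ[x] a₀ a₀∈x (trans (sym (at-len p)) (trans (cong (at p) len≡0) (at-0 p)))

  impossible : ⊥
  impossible = no-long-excursion t excursion (m≤n+m t _)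

lemma8 : ∀ {n k : ℕ} (C : Fin k → PartialCharacter n) → DistinctCharacters C →
    (H : Rel₀ (Vtx C)) → MinimalTriangulation (Int C) H →
    ∀ {t : ℕ} (T : Rel₀ (Fin t)) (K : Fin t → Vtx C → Set) → CliqueTree H T K →
    (φ : Fin n → Fin t) → (∀ (a : Fin n) → Candidate C K (φ a) a) →
    ∀ (x : Vtx C) →
      IsMinimalSubtreeContaining T
        (λ v → ∃ λ (a : Fin n) → a ∈ cellOf C x × φ a ≡ v)
        (λ v → K v x)
lemma8 C _ H minimal T K clique-tree φ candidate x =
  connected x , (λ v (a , a∈x , φa≡v) → subst (λ z → K z x) φa≡v (candidate a x a∈x)) , least
  where
  open CliqueTree clique-tree using (connected)
  least : ∀ U → Subtree T U → (λ v → ∃ λ a → a ∈ cellOf C x × φ a ≡ v) ⊆P U → (λ v → K v x) ⊆P U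
  least U U-subtree φ[x]⊆U v Kvx with All.lookup (nonempty (C (proj₁ x))) (∈-lookup (proj₂ x))
  ... | a₀ , a₀∈x with any? (λ b → (b ∈? cellOf C x) ×-dec (φ b ≟ᶠ v))
  ...   | yes v∈φ[x] = φ[x]⊆U v v∈φ[x]
  ...   | no v∉φ[x]
    with subtree-through-or-around U-subtree (cellOf C x) φ (λ b b∈x → φ[x]⊆U _ (b , b∈x , refl)) a₀∈x v
  ...     | inj₁ v∈U = v∈U
  ...     | inj₂ bypass = ⊥-elim (Excursions.impossible {C = C} minimal clique-tree candidate x Kvx a₀∈x
                                    (λ b b∈x φb≡v → v∉φ[x] (b , b∈x , φb≡v)) bypass)
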